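{- For any graph $A$ it holds that $A \triangleright F(3,0)$ if and only if $A \longrightarrow F(3,0)$.
   Context: A graph has finite vertex and edge sets; every edge is either a normal edge (incident with two distinct vertices, adding 1 to the degree of each), a loop (incident with one vertex, adding 2 to its degree) or a semi-edge (incident with one vertex, adding 1 to its degree). Multiple loops, multiple semi-edges and parallel normal edges are allowed. A graph is simple if it has no loops, no semi-edges and no parallel normal edges. A covering projection from a graph $G$ to a connected graph $H$ is a pair of surjective maps $f_V:V(G)\to V(H)$, $f_E:E(G)\to E(H)$ such that $f_V$ preserves degrees; $f_E$ maps semi-edges onto semi-edges and loops onto loops (normal edges may be mapped onto normal edges, loops or semi-edges); $f_E$ preserves incidence (if $e$ is incident with $u,v$ then $f_E(e)$ is incident with $f_V(u),f_V(v)$); and $f_E$ is a local bijection between the edge-neighborhood of every vertex and that of its image. In particular, the preimage of a normal edge $uv$ is a perfect matching between $f_V^{ -1}(u)$ and $f_V^{ -1}(v)$, the preimage of a loop at $u$ is a disjoint union of cycles spanning $f_V^{ -1}(u)$ (a loop is a cycle of length 1, two parallel edges a cycle of length 2), and the preimage of a semi-edge at $u$ is a disjoint union of semi-edges and normal edges spanning $f_V^{ -1}(u)$ (each vertex of the fiber incident with exactly one of them). $G$ covers $H$, written $G\longrightarrow H$, if such a projection exists. $A \triangleright B$ ("$A$ is stronger than $B$") means: every simple graph $G$ with $G\longrightarrow A$ also satisfies $G\longrightarrow B$. $F(a,b)$ denotes the one-vertex graph with $a$ semi-edges and $b$ loops. -}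

module Defs where

open import Data.Nat using (ℕ; zero; suc; _+_; _≤_)
open import Data.Fin using (Fin; splitAt) renaming (_≟_ to _≟F_)
open import Data.Bool using (Bool; true; false; if_then_else_)
open import Data.Sum using (_⊎_; inj₁; inj₂)
open import Data.Product using (Σ; _×_; _,_; ∃; ∃-syntax)
open import Relation.Nullary using (¬_; does)
open import Relation.Binary.PropositionalEquality using (_≡_; _≢_)
open import Function using (_∘_)
open import Data.Empty using (⊥)
import Data.Fin

∑ : (n : ℕ) → (Fin n → ℕ) → ℕ
∑ zero    f = 0
∑ (suc n) f = f Data.Fin.zero + ∑ n (f ∘ Data.Fin.suc)

data Edge (n : ℕ) : Set where
  normal : (u v : Fin n) → u ≢ v → Edge n
  loop   : Fin n → Edge n
  semi   : Fin n → Edge n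

record Graph : Set where
  constructor graph
  field
    V    : ℕ
    E    : ℕ
    ends : Fin E → Edge V
open Graph public

δ : {n : ℕ} → Fin n → Fin n → ℕ
δ u x = if does (u ≟F x) then 1 else 0

endsAt : {n : ℕ} → Edge n → Fin n → ℕ
endsAt (normal u v _) x = δ u x + δ v x
endsAt (loop u)       x = δ u x + δ u x
endsAt (semi u)       x = δ u x

isLoop : {n : ℕ} → Edge n → Bool
isLoop (loop _) = true
isLoop _        = false

isSemi : {n : ℕ} → Edge n → Bool
isSemi (semi _) = true
isSemi _        = false

isNormal : {n : ℕ} → Edge n → Bool
isNormal (normal _ _ _) = true
isNormal _              = false

Parallel : {n : ℕ} → Edge n → Edge n → Set
Parallel (normal u v _) (normal u' v' _) = (u ≡ u' × v ≡ v') ⊎ (u ≡ v' × v ≡ u')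
Parallel _ _ = ⊥

deg : (G : Graph) → Fin (V G) → ℕ
deg G x = ∑ (E G) (λ e → endsAt (ends G e) x)

Incident : (G : Graph) → Fin (V G) → Fin (E G) → Set
Incident G x e = 1 ≤ endsAt (ends G e) x

Simple : Graph → Set
Simple G = (∀ e → isNormal (ends G e) ≡ true)
         × (∀ e e' → e ≢ e' → ¬ Parallel (ends G e) (ends G e'))

data Reach (G : Graph) : Fin (V G) → Fin (V G) → Set where
  here : ∀ {u} → Reach G u u
  step : ∀ {u w v} (e : Fin (E G)) → Incident G u e → Incident G w e
       → Reach G w v → Reach G u v

Connected : Graph → Set
Connected G = ∀ u v → Reach G u v

Surjective : {A B : Set} → (A → B) → Set
Surjective {A} {B} f = ∀ (b : B) → ∃[ a ] f a ≡ b

-- Local bijection between edge-neighbourhoods (as multisets, a loop counted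
-- twice) is written out as: for each vertex x of G and each edge h of H,
-- the number of edge-ends at x of edges mapped to h equals the number of
-- ends of h at fV x.
record CoveringProjection (G H : Graph) : Set where
  field
    fV        : Fin (V G) → Fin (V H)
    fE        : Fin (E G) → Fin (E H)
    surjV     : Surjective fV
    surjE     : Surjective fE
    degree    : ∀ x → deg G x ≡ deg H (fV x)
    semi↦semi : ∀ e → isSemi (ends G e) ≡ true → isSemi (ends H (fE e)) ≡ true
    loop↦loop : ∀ e → isLoop (ends G e) ≡ true → isLoop (ends H (fE e)) ≡ true
    incidence : ∀ e x → Incident G x e → Incident H (fV x) (fE e)
    localBij  : ∀ x h →
      ∑ (E G) (λ e → if does (fE e ≟F h) then endsAt (ends G e) x else 0)
        ≡ endsAt (ends H h) (fV x)

_⟶_ : Graph → Graph → Set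
G ⟶ H = Connected H × CoveringProjection G H

_▷_ : Graph → Graph → Set
A ▷ B = ∀ (G : Graph) → Simple G → G ⟶ A → G ⟶ B

F : ℕ → ℕ → Graph
F a b = graph 1 (a + b) edge
  where
    edge : Fin (a + b) → Edge 1
    edge i with splitAt a i
    ... | inj₁ _ = semi Data.Fin.zero
    ... | inj₂ _ = loop Data.Fin.zero

-- Covers of F(3,0) are the graphs with a Tait colouring: every vertex meets each of three colours
-- exactly once.  Suppose A ▷ F(3,0).  Some simple graph covers A (cyclic shifts along the darts of A),
-- so A is cubic.  In a double cover of A without semi-edges, replace every edge by a copy of
-- K₃,₃ minus an edge, attached by two pendant edges: this is a simple cover of A, hence Tait coloured.
-- By the parity lemma the two pendant edges of each gadget get the same colour, so the colouring
-- descends to the double cover and, restricted to one sheet, to A.  Conversely, coverings compose.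

module Submission where

open import Defs

open import Data.Bool using (true; false; if_then_else_)
open import Data.Empty using (⊥-elim)
open import Data.Fin as Fin using (Fin; toℕ; fromℕ<; _↑ˡ_; _↑ʳ_; splitAt; join; combine; remQuot; cast) renaming (_≟_ to _≟F_)
open import Data.Fin.Patterns using (0F; 1F; 2F; 3F; 4F; 5F; 6F; 7F; 8F; 9F)
open import Data.Fin.Permutation using (Permutation′; permutation; cast-id)
open import Data.Fin.Properties
  using (0≢1+n; all?; any?; toℕ-injective; toℕ-fromℕ<; toℕ<n; ↑ˡ-injective; ↑ʳ-injective; splitAt-↑ˡ; splitAt-↑ʳ;
         splitAt⁻¹-↑ˡ; splitAt⁻¹-↑ʳ; splitAt-join; join-splitAt; remQuot-combine; combine-remQuot; combine-injective; cast-involutive)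
open import Data.Maybe using (Maybe; just; nothing)
import Data.Maybe as Maybe
import Data.Maybe.Properties as Maybe
open import Data.Nat using (ℕ; zero; suc; _+_; _*_; _∸_; _≤_; _<_; z≤n; s≤s; NonZero)
open import Data.Nat.DivMod using (_%_; m%n<n; %-distribˡ-+; m%n%n≡m%n; [m+n]%n≡m%n; m<n⇒m%n≡m)
open import Data.Nat.Properties
  using (_≟_; +-*-semiring; *-commutativeSemigroup; +-assoc; +-comm; +-identityʳ; *-comm; *-zeroʳ; *-identityʳ;
         *-distribˡ-+; *-distribʳ-+; m≤m+n; m≤n+m; ≤-trans; <⇒≤; m∸n+n≡m; m∸[m∸n]≡n; m∸n≤m; even≢odd)
open import Algebra.Properties.CommutativeSemigroup *-commutativeSemigroup using (x∙yz≈y∙xz)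
open import Algebra.Properties.Semiring.Sum +-*-semiring
  using (sum; sum-cong-≗; ∑-distrib-+; ∑-comm; ∑-permute; *-distribˡ-sum; *-distribʳ-sum)
open import Data.Nat.Tactic.RingSolver using (solve-∀)
open import Data.Product using (Σ; _×_; _,_; proj₁; proj₂; ∃-syntax; uncurry)
open import Data.Sum using (_⊎_; inj₁; inj₂; [_,_]′)
import Data.Sum as Sum
open import Data.Vec using ([]; _∷_; lookup)
open import Function using (_∘_; id)
open import Function.Bundles using (_⇔_; mk⇔)
open import Relation.Binary.PropositionalEquality
open import Relation.Nullary using (¬_; does; yes; no; Dec; ¬?; _×-dec_; _⊎-dec_)
open import Relation.Nullary.Decidable using (from-yes; dec⇒maybe)

∑≡sum : ∀ n (f : Fin n → ℕ) → ∑ n f ≡ sum f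
∑≡sum zero    f = refl
∑≡sum (suc n) f = cong (f 0F +_) (∑≡sum n (f ∘ Fin.suc))

sum-const : ∀ n c → sum {n} (λ _ → c) ≡ n * c
sum-const zero    c = refl
sum-const (suc n) c = cong (c +_) (sum-const n c)

sum-↑ : ∀ m {n} (f : Fin (m + n) → ℕ) → sum f ≡ sum (λ i → f (i ↑ˡ n)) + sum (λ j → f (m ↑ʳ j))
sum-↑ zero    f = refl
sum-↑ (suc m) f = trans (cong (f 0F +_) (sum-↑ m (f ∘ Fin.suc))) (sym (+-assoc (f 0F) _ _))

sum-combine : ∀ m n (f : Fin (m * n) → ℕ) → sum f ≡ sum {m} (λ i → sum {n} (λ j → f (combine i j)))
sum-combine zero    n f = refl
sum-combine (suc m) n f = trans (sum-↑ n f) (cong (sum (λ j → f (j ↑ˡ m * n)) +_) (sum-combine m n (λ k → f (n ↑ʳ k))))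

≤-sum : ∀ {n} (f : Fin n → ℕ) i → f i ≤ sum f
≤-sum f 0F          = m≤m+n _ _
≤-sum f (Fin.suc i) = ≤-trans (≤-sum (f ∘ Fin.suc) i) (m≤n+m _ _)

sum-positive : ∀ {n} (f : Fin n → ℕ) → 1 ≤ sum f → ∃[ i ] 1 ≤ f i
sum-positive {suc n} f p with f 0F in eq
... | suc _ = 0F , subst (1 ≤_) (sym eq) (s≤s z≤n)
... | zero  = let (i , q) = sum-positive (f ∘ Fin.suc) p in Fin.suc i , q

combine-elim : ∀ {m n} (P : Fin (m * n) → Set) → (∀ i j → P (combine i j)) → ∀ k → P k
combine-elim {m} {n} P f k = subst P (combine-remQuot {m} n k) (f (proj₁ (remQuot {m} n k)) (proj₂ (remQuot {m} n k)))

sum-remQuot : ∀ m n (f : Fin m × Fin n → ℕ) → sum (f ∘ remQuot {m} n) ≡ sum (λ i → sum (λ j → f (i , j)))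
sum-remQuot m n f = trans (sum-combine m n (f ∘ remQuot n)) (sum-cong-≗ (λ i → sum-cong-≗ (λ j → cong f (remQuot-combine i j))))

split : ∀ {n} (k : Fin n → ℕ) → Fin (sum k) → Σ (Fin n) (Fin ∘ k)
split {suc n} k i with splitAt (k 0F) i
... | inj₁ j = 0F , j
... | inj₂ i′ = let (a , j) = split (k ∘ Fin.suc) i′ in Fin.suc a , j

merge : ∀ {n} (k : Fin n → ℕ) → Σ (Fin n) (Fin ∘ k) → Fin (sum k)
merge {suc n} k (0F , j)        = j ↑ˡ sum (k ∘ Fin.suc)
merge {suc n} k (Fin.suc a , j) = k 0F ↑ʳ merge (k ∘ Fin.suc) (a , j)

split-↑ˡ : ∀ {n} (k : Fin (suc n) → ℕ) j → split k (j ↑ˡ sum (k ∘ Fin.suc)) ≡ (0F , j)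
split-↑ˡ k j rewrite splitAt-↑ˡ (k 0F) j (sum (k ∘ Fin.suc)) = refl

split-↑ʳ : ∀ {n} (k : Fin (suc n) → ℕ) i → split k (k 0F ↑ʳ i) ≡ (Fin.suc (proj₁ (split (k ∘ Fin.suc) i)) , proj₂ (split (k ∘ Fin.suc) i))
split-↑ʳ k i rewrite splitAt-↑ʳ (k 0F) (sum (k ∘ Fin.suc)) i = refl

split-merge : ∀ {n} (k : Fin n → ℕ) p → split k (merge k p) ≡ p
split-merge {suc n} k (0F , j)        = split-↑ˡ k j
split-merge {suc n} k (Fin.suc a , j) = trans (split-↑ʳ k _) (cong (λ p → Fin.suc (proj₁ p) , proj₂ p) (split-merge (k ∘ Fin.suc) (a , j)))

merge-split : ∀ {n} (k : Fin n → ℕ) i → merge k (split k i) ≡ i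
merge-split {suc n} k i with splitAt (k 0F) i in eq
... | inj₁ j  = splitAt⁻¹-↑ˡ eq
... | inj₂ i′ = trans (cong (k 0F ↑ʳ_) (merge-split (k ∘ Fin.suc) i′)) (splitAt⁻¹-↑ʳ eq)

sum-split : ∀ {n} (k : Fin n → ℕ) (f : Σ (Fin n) (Fin ∘ k) → ℕ) →
            sum (f ∘ split k) ≡ sum (λ a → sum (λ j → f (a , j)))
sum-split {zero}  k f = refl
sum-split {suc n} k f = begin
  sum (f ∘ split k)
    ≡⟨ sum-↑ (k 0F) (f ∘ split k) ⟩
  sum (λ j → f (split k (j ↑ˡ rest))) + sum {rest} (λ i → f (split k (k 0F ↑ʳ i)))
    ≡⟨ cong₂ _+_ (sum-cong-≗ (cong f ∘ split-↑ˡ k)) (sum-cong-≗ (cong f ∘ split-↑ʳ k)) ⟩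
  sum (λ j → f (0F , j)) + sum {rest} (λ i → f (Fin.suc (proj₁ (split (k ∘ Fin.suc) i)) , proj₂ (split (k ∘ Fin.suc) i)))
    ≡⟨ cong (sum (λ j → f (0F , j)) +_) (sum-split (k ∘ Fin.suc) (λ p → f (Fin.suc (proj₁ p) , proj₂ p))) ⟩
  sum (λ a → sum (λ j → f (a , j))) ∎
  where
  open ≡-Reasoning
  rest : ℕ
  rest = sum (k ∘ Fin.suc)

δ-refl : ∀ {n} (i : Fin n) → δ i i ≡ 1
δ-refl i with i ≟F i
... | yes _  = refl
... | no i≢i = ⊥-elim (i≢i refl)

δ-≢ : ∀ {n} {i j : Fin n} → i ≢ j → δ i j ≡ 0
δ-≢ {i = i} {j} i≢j with i ≟F j
... | yes i≡j = ⊥-elim (i≢j i≡j)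
... | no _    = refl

δ-sym : ∀ {n} (i j : Fin n) → δ i j ≡ δ j i
δ-sym i j with i ≟F j
... | yes refl = sym (δ-refl i)
... | no i≢j   = sym (δ-≢ (i≢j ∘ sym))

δ-positive : ∀ {n} {i j : Fin n} x → 1 ≤ δ i j * x → i ≡ j
δ-positive {i = i} {j} x p with i ≟F j
... | yes i≡j = i≡j

δ-injective : ∀ {m n} (f : Fin m → Fin n) → (∀ {i j} → f i ≡ f j → i ≡ j) → ∀ i j → δ (f i) (f j) ≡ δ i j
δ-injective f f-inj i j with i ≟F j
... | yes refl = δ-refl (f i)
... | no i≢j   = δ-≢ (i≢j ∘ f-inj)

δ-combine : ∀ {m n} (i k : Fin m) (j l : Fin n) → δ (combine i j) (combine k l) ≡ δ i k * δ j l
δ-combine i k j l with i ≟F k | j ≟F l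
... | yes refl | yes refl = δ-refl (combine i j)
... | yes refl | no j≢l   = δ-≢ (j≢l ∘ proj₂ ∘ combine-injective i j i l)
... | no i≢k   | _        = δ-≢ (i≢k ∘ proj₁ ∘ combine-injective i j k l)

δ-↑ˡ↑ʳ : ∀ {m n} (i : Fin m) (j : Fin n) → δ (i ↑ˡ n) (m ↑ʳ j) ≡ 0
δ-↑ˡ↑ʳ {m} {n} i j = δ-≢ λ eq → inj₁≢inj₂ (trans (sym (splitAt-↑ˡ m i n)) (trans (cong (splitAt m) eq) (splitAt-↑ʳ m n j)))
  where
  inj₁≢inj₂ : inj₁ i ≢ inj₂ j
  inj₁≢inj₂ ()

δ-combine₃ : ∀ {l m n} (x x′ : Fin l) (b b′ : Fin m) (i i′ : Fin n) →
             δ (combine x (combine b i)) (combine x′ (combine b′ i′)) ≡ δ x x′ * (δ b b′ * δ i i′)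
δ-combine₃ x x′ b b′ i i′ = trans (δ-combine x x′ (combine b i) (combine b′ i′)) (cong (δ x x′ *_) (δ-combine b b′ i i′))

δ₀+δ₁≡1 : ∀ (b : Fin 2) → δ 0F b + δ 1F b ≡ 1
δ₀+δ₁≡1 0F = refl
δ₀+δ₁≡1 1F = refl

sum-δˡ : ∀ {n} (j : Fin n) (f : Fin n → ℕ) → sum (λ i → δ i j * f i) ≡ f j
sum-δˡ {suc n} 0F          f = trans (cong₂ _+_ (+-identityʳ (f 0F)) (trans (sum-const n 0) (*-zeroʳ n))) (+-identityʳ (f 0F))
sum-δˡ {suc n} (Fin.suc j) f = sum-δˡ j (f ∘ Fin.suc)

sum-δʳ : ∀ {n} (i : Fin n) (f : Fin n → ℕ) → sum (λ j → δ i j * f j) ≡ f i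
sum-δʳ i f = trans (sum-cong-≗ (λ j → cong (_* f j) (δ-sym i j))) (sum-δˡ i f)

sum-δ : ∀ {n} (j : Fin n) → sum (λ i → δ i j) ≡ 1
sum-δ j = trans (sum-cong-≗ (λ i → sym (*-identityʳ (δ i j)))) (sum-δˡ j (λ _ → 1))

sum-δ′ : ∀ {n} (i : Fin n) → sum (λ j → δ i j) ≡ 1
sum-δ′ i = trans (sum-cong-≗ (δ-sym i)) (sum-δ i)

sum-fibres : ∀ {m n} (f : Fin m → Fin n) (g : Fin n → ℕ) (w : Fin m → ℕ) →
             sum (λ e → g (f e) * w e) ≡ sum (λ h → g h * sum (λ e → δ (f e) h * w e))
sum-fibres f g w = sym (begin
  sum (λ h → g h * sum (λ e → δ (f e) h * w e))
    ≡⟨ sum-cong-≗ (λ h → *-distribˡ-sum (g h) (λ e → δ (f e) h * w e)) ⟩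
  sum (λ h → sum (λ e → g h * (δ (f e) h * w e)))
    ≡⟨ ∑-comm (λ h e → g h * (δ (f e) h * w e)) ⟩
  sum (λ e → sum (λ h → g h * (δ (f e) h * w e)))
    ≡⟨ sum-cong-≗ (λ e → sum-cong-≗ (λ h → x∙yz≈y∙xz (g h) (δ (f e) h) (w e))) ⟩
  sum (λ e → sum (λ h → δ (f e) h * (g h * w e)))
    ≡⟨ sum-cong-≗ (λ e → sum-δʳ (f e) (λ h → g h * w e)) ⟩
  sum (λ e → g (f e) * w e) ∎)
  where open ≡-Reasoning

sum-incidence : ∀ {m n} (w c : Fin m → ℕ) (ι : Fin n → Fin m) → (∀ k → c k ≡ sum (λ j → δ (ι j) k)) →
                sum (λ k → w k * c k) ≡ sum (w ∘ ι)
sum-incidence w c ι c≡ = begin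
  sum (λ k → w k * c k)                     ≡⟨ sum-cong-≗ (λ k → trans (cong (w k *_) (c≡ k)) (*-distribˡ-sum (w k) (λ j → δ (ι j) k))) ⟩
  sum (λ k → sum (λ j → w k * δ (ι j) k))   ≡⟨ ∑-comm (λ k j → w k * δ (ι j) k) ⟩
  sum (λ j → sum (λ k → w k * δ (ι j) k))   ≡⟨ sum-cong-≗ (λ j → trans (sum-cong-≗ (λ k → *-comm (w k) (δ (ι j) k))) (sum-δʳ (ι j) w)) ⟩
  sum (w ∘ ι)                               ∎
  where open ≡-Reasoning

module Rotation (N : ℕ) .{{_ : NonZero N}} where

  rotate : ℕ → Fin N → Fin N
  rotate k i = fromℕ< (m%n<n (k + toℕ i) N)

  toℕ-rotate : ∀ k i → toℕ (rotate k i) ≡ (k + toℕ i) % N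
  toℕ-rotate k i = toℕ-fromℕ< (m%n<n (k + toℕ i) N)

  private
    %-absorbʳ : ∀ a b → (a + b % N) % N ≡ (a + b) % N
    %-absorbʳ a b = begin
      (a + b % N) % N           ≡⟨ %-distribˡ-+ a (b % N) N ⟩
      (a % N + b % N % N) % N   ≡⟨ cong (λ z → (a % N + z) % N) (m%n%n≡m%n b N) ⟩
      (a % N + b % N) % N       ≡⟨ sym (%-distribˡ-+ a b N) ⟩
      (a + b) % N               ∎
      where open ≡-Reasoning

    unrotate : ∀ x y → x ≤ N → y < N → ((N ∸ x) + (x + y) % N) % N ≡ y
    unrotate x y x≤N y<N = begin
      ((N ∸ x) + (x + y) % N) % N   ≡⟨ %-absorbʳ (N ∸ x) (x + y) ⟩
      ((N ∸ x) + (x + y)) % N       ≡⟨ cong (_% N) (sym (+-assoc (N ∸ x) x y)) ⟩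
      ((N ∸ x) + x + y) % N         ≡⟨ cong (λ z → (z + y) % N) (m∸n+n≡m x≤N) ⟩
      (N + y) % N                   ≡⟨ cong (_% N) (+-comm N y) ⟩
      (y + N) % N                   ≡⟨ [m+n]%n≡m%n y N ⟩
      y % N                         ≡⟨ m<n⇒m%n≡m y<N ⟩
      y                             ∎
      where open ≡-Reasoning

  rotate-inverseʳ : ∀ {k} → k ≤ N → ∀ i → rotate (N ∸ k) (rotate k i) ≡ i
  rotate-inverseʳ {k} k≤N i = toℕ-injective (begin
    toℕ (rotate (N ∸ k) (rotate k i))   ≡⟨ toℕ-rotate (N ∸ k) (rotate k i) ⟩
    ((N ∸ k) + toℕ (rotate k i)) % N    ≡⟨ cong (λ z → ((N ∸ k) + z) % N) (toℕ-rotate k i) ⟩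
    ((N ∸ k) + (k + toℕ i) % N) % N     ≡⟨ unrotate k (toℕ i) k≤N (toℕ<n i) ⟩
    toℕ i                               ∎)
    where open ≡-Reasoning

  rotate-inverseˡ : ∀ {k} → k ≤ N → ∀ j → rotate k (rotate (N ∸ k) j) ≡ j
  rotate-inverseˡ {k} k≤N j = trans (cong (λ z → rotate z (rotate (N ∸ k) j)) (sym (m∸[m∸n]≡n k≤N)))
                                    (rotate-inverseʳ (m∸n≤m N k) j)

  rotation : ∀ k → k ≤ N → Permutation′ N
  rotation k k≤N = permutation (rotate k) (rotate (N ∸ k)) (rotate-inverseˡ k≤N) (rotate-inverseʳ k≤N)

  sum-rotate : ∀ {k} → k ≤ N → (f : Fin N → ℕ) → sum (f ∘ rotate k) ≡ sum f
  sum-rotate {k} k≤N f = sym (∑-permute f (rotation k k≤N))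

  rotate-injectiveˡ : ∀ {k k′} i → k < N → k′ < N → rotate k i ≡ rotate k′ i → k ≡ k′
  rotate-injectiveˡ {k} {k′} i k<N k′<N eq = begin
    k                                    ≡⟨ sym (unrotate (toℕ i) k i≤N k<N) ⟩
    ((N ∸ toℕ i) + (toℕ i + k) % N) % N  ≡⟨ cong (λ z → ((N ∸ toℕ i) + z) % N) same ⟩
    ((N ∸ toℕ i) + (toℕ i + k′) % N) % N ≡⟨ unrotate (toℕ i) k′ i≤N k′<N ⟩
    k′                                   ∎
    where
    open ≡-Reasoning
    i≤N : toℕ i ≤ N
    i≤N = <⇒≤ (toℕ<n i)
    same : (toℕ i + k) % N ≡ (toℕ i + k′) % N
    same = begin
      (toℕ i + k) % N         ≡⟨ cong (_% N) (+-comm (toℕ i) k) ⟩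
      (k + toℕ i) % N         ≡⟨ sym (toℕ-rotate k i) ⟩
      toℕ (rotate k i)        ≡⟨ cong toℕ eq ⟩
      toℕ (rotate k′ i)       ≡⟨ toℕ-rotate k′ i ⟩
      (k′ + toℕ i) % N        ≡⟨ cong (_% N) (+-comm k′ (toℕ i)) ⟩
      (toℕ i + k′) % N        ∎

  sum-δ-rotate : ∀ {k} → k ≤ N → ∀ j → sum (λ i → δ (rotate k i) j) ≡ 1
  sum-δ-rotate k≤N j = trans (sum-rotate k≤N (λ i → δ i j)) (sum-δ j)

-- Covering projections

source target : ∀ {n} → Edge n → Fin n
source (normal u _ _) = u
source (loop u)       = u
source (semi u)       = u
target (normal _ v _) = v
target (loop u)       = u
target (semi u)       = u

endsAt-source : ∀ {n} (e : Edge n) → 1 ≤ endsAt e (source e)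
endsAt-source (normal u _ _) rewrite δ-refl u = s≤s z≤n
endsAt-source (loop u)       rewrite δ-refl u = s≤s z≤n
endsAt-source (semi u)       rewrite δ-refl u = s≤s z≤n

endsAt-nonSemi : ∀ {n} (e : Edge n) x → isSemi e ≡ false → endsAt e x ≡ δ (source e) x + δ (target e) x
endsAt-nonSemi (normal _ _ _) _ _ = refl
endsAt-nonSemi (loop _)       _ _ = refl

weightedDegree : (G : Graph) → (Fin (E G) → ℕ) → Fin (V G) → ℕ
weightedDegree G w x = sum (λ e → w e * endsAt (ends G e) x)

endsOver : (G : Graph) {n : ℕ} → (Fin (E G) → Fin n) → Fin n → Fin (V G) → ℕ
endsOver G f h = weightedDegree G (λ e → δ (f e) h)

endsAt≤endsOver : ∀ G {n} (f : Fin (E G) → Fin n) e x → endsAt (ends G e) x ≤ endsOver G f (f e) x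
endsAt≤endsOver G f e x = subst (_≤ endsOver G f (f e) x) (trans (cong (_* endsAt (ends G e) x) (δ-refl (f e))) (+-identityʳ _))
                                (≤-sum (λ e′ → δ (f e′) (f e) * endsAt (ends G e′) x) e)

deg-endsOver : ∀ G {n} (f : Fin (E G) → Fin n) x → deg G x ≡ sum (λ h → endsOver G f h x)
deg-endsOver G {n} f x = begin
  deg G x                                        ≡⟨ ∑≡sum (E G) _ ⟩
  sum (λ e → endsAt (ends G e) x)                ≡⟨ sum-cong-≗ (λ e → sym (+-identityʳ (endsAt (ends G e) x))) ⟩
  sum (λ e → 1 * endsAt (ends G e) x)            ≡⟨ sum-fibres f (λ _ → 1) (λ e → endsAt (ends G e) x) ⟩
  sum {n} (λ h → 1 * endsOver G f h x)           ≡⟨ sum-cong-≗ (λ h → +-identityʳ (endsOver G f h x)) ⟩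
  sum {n} (λ h → endsOver G f h x)               ∎
  where open ≡-Reasoning

endsOver-∘ : ∀ G {m n} (f : Fin (E G) → Fin m) (g : Fin m → Fin n) c x →
             endsOver G (g ∘ f) c x ≡ sum (λ h → δ (g h) c * endsOver G f h x)
endsOver-∘ G f g c x = sum-fibres f (λ h → δ (g h) c) (λ e → endsAt (ends G e) x)

localBij≡endsOver : ∀ G {n} (f : Fin (E G) → Fin n) h x →
  ∑ (E G) (λ e → if does (f e ≟F h) then endsAt (ends G e) x else 0) ≡ endsOver G f h x
localBij≡endsOver G f h x = trans (∑≡sum (E G) _) (sum-cong-≗ if≡δ*)
  where
  if≡δ* : ∀ e → (if does (f e ≟F h) then endsAt (ends G e) x else 0) ≡ δ (f e) h * endsAt (ends G e) x
  if≡δ* e with f e ≟F h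
  ... | yes _ = sym (+-identityʳ _)
  ... | no _  = refl

module _ {G H : Graph} (π : CoveringProjection G H) where
  open CoveringProjection π

  endsOver-covering : ∀ x h → endsOver G fE h x ≡ endsAt (ends H h) (fV x)
  endsOver-covering x h = trans (sym (localBij≡endsOver G fE h x)) (localBij x h)

mkCovering : ∀ (G H : Graph) (fV : Fin (V G) → Fin (V H)) (fE : Fin (E G) → Fin (E H)) → Surjective fV →
  (∀ e → isSemi (ends G e) ≡ true → isSemi (ends H (fE e)) ≡ true) →
  (∀ e → isLoop (ends G e) ≡ true → isLoop (ends H (fE e)) ≡ true) →
  (∀ x h → endsOver G fE h x ≡ endsAt (ends H h) (fV x)) →
  CoveringProjection G H
mkCovering G H fV fE fV-surjective semi↦semi loop↦loop counts = record
  { fV        = fV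
  ; fE        = fE
  ; surjV     = fV-surjective
  ; surjE     = fE-surjective
  ; degree    = λ x → trans (deg-endsOver G fE x) (trans (sum-cong-≗ (λ h → counts x h)) (sym (∑≡sum (E H) _)))
  ; semi↦semi = semi↦semi
  ; loop↦loop = loop↦loop
  ; incidence = incidence
  ; localBij  = λ x h → trans (localBij≡endsOver G fE h x) (counts x h)
  }
  where
  incidence : ∀ e x → Incident G x e → Incident H (fV x) (fE e)
  incidence e x 1≤ends = subst (1 ≤_) (counts x (fE e)) (≤-trans 1≤ends (endsAt≤endsOver G fE e x))

  fE-surjective : Surjective fE
  fE-surjective h =
    let (x , fVx≡p) = fV-surjective (source (ends H h))
        1≤endsOver = subst (1 ≤_) (sym (trans (counts x h) (cong (endsAt (ends H h)) fVx≡p))) (endsAt-source (ends H h))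
        (e , 1≤term) = sum-positive _ 1≤endsOver
    in e , δ-positive (endsAt (ends G e) x) 1≤term

covering-trans : ∀ {G H K} → CoveringProjection G H → CoveringProjection H K → CoveringProjection G K
covering-trans {G} {H} {K} π ρ = record
  { fV        = ρ.fV ∘ π.fV
  ; fE        = ρ.fE ∘ π.fE
  ; surjV     = λ c → let (b , ρb≡c) = ρ.surjV c ; (a , πa≡b) = π.surjV b in a , trans (cong ρ.fV πa≡b) ρb≡c
  ; surjE     = λ c → let (b , ρb≡c) = ρ.surjE c ; (a , πa≡b) = π.surjE b in a , trans (cong ρ.fE πa≡b) ρb≡c
  ; degree    = λ x → trans (π.degree x) (ρ.degree (π.fV x))
  ; semi↦semi = λ e → ρ.semi↦semi (π.fE e) ∘ π.semi↦semi e
  ; loop↦loop = λ e → ρ.loop↦loop (π.fE e) ∘ π.loop↦loop e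
  ; incidence = λ e x → ρ.incidence (π.fE e) (π.fV x) ∘ π.incidence e x
  ; localBij  = λ x c → trans (localBij≡endsOver G (ρ.fE ∘ π.fE) c x) (counts x c)
  }
  where
  module π = CoveringProjection π
  module ρ = CoveringProjection ρ
  open ≡-Reasoning
  counts : ∀ x c → endsOver G (ρ.fE ∘ π.fE) c x ≡ endsAt (ends K c) (ρ.fV (π.fV x))
  counts x c = begin
    endsOver G (ρ.fE ∘ π.fE) c x                              ≡⟨ endsOver-∘ G π.fE ρ.fE c x ⟩
    sum (λ h → δ (ρ.fE h) c * endsOver G π.fE h x)            ≡⟨ sum-cong-≗ (λ h → cong (δ (ρ.fE h) c *_) (endsOver-covering π x h)) ⟩
    sum (λ h → δ (ρ.fE h) c * endsAt (ends H h) (π.fV x))     ≡⟨ endsOver-covering ρ (π.fV x) c ⟩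
    endsAt (ends K c) (ρ.fV (π.fV x))                         ∎

normals : ∀ {n m} (src tgt : Fin m → Fin n) → (∀ e → src e ≢ tgt e) → Graph
normals {n} {m} src tgt src≢tgt = graph n m (λ e → normal (src e) (tgt e) (src≢tgt e))

module _ {n m} (src tgt : Fin m → Fin n) (src≢tgt : ∀ e → src e ≢ tgt e) where

  normals-simple : (∀ e e′ → (src e ≡ src e′ × tgt e ≡ tgt e′) ⊎ (src e ≡ tgt e′ × tgt e ≡ src e′) → e ≡ e′) →
                   Simple (normals src tgt src≢tgt)
  normals-simple ends-determine = (λ _ → refl) , λ e e′ e≢e′ → e≢e′ ∘ ends-determine e e′

  normals-covering : ∀ H (fV : Fin n → Fin (V H)) (fE : Fin m → Fin (E H)) → Surjective fV →
    (∀ x h → endsOver (normals src tgt src≢tgt) fE h x ≡ endsAt (ends H h) (fV x)) →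
    CoveringProjection (normals src tgt src≢tgt) H
  normals-covering H fV fE fV-surjective = mkCovering _ H fV fE fV-surjective (λ _ ()) (λ _ ())

-- Tait colourings

F30-semi : ∀ c → ends (F 3 0) c ≡ semi 0F
F30-semi 0F = refl
F30-semi 1F = refl
F30-semi 2F = refl

F30-connected : Connected (F 3 0)
F30-connected 0F 0F = here

endsAt-F30 : ∀ c x → endsAt (ends (F 3 0) c) x ≡ 1
endsAt-F30 c 0F rewrite F30-semi c = refl

Cubic : Graph → Set
Cubic G = ∀ x → deg G x ≡ 3

cubic-base : ∀ {G A} → CoveringProjection G A → CoveringProjection G (F 3 0) → Cubic A
cubic-base {G} {A} π χ a =
  let (x , πx≡a) = CoveringProjection.surjV π a in begin
  deg A a                             ≡⟨ cong (deg A) (sym πx≡a) ⟩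
  deg A (CoveringProjection.fV π x)   ≡⟨ sym (CoveringProjection.degree π x) ⟩
  deg G x                             ≡⟨ CoveringProjection.degree χ x ⟩
  deg (F 3 0) (CoveringProjection.fV χ x) ≡⟨ deg-F30 (CoveringProjection.fV χ x) ⟩
  3                                   ∎
  where
  open ≡-Reasoning
  deg-F30 : ∀ x → deg (F 3 0) x ≡ 3
  deg-F30 0F = refl

IsTaitColouring : (G : Graph) → (Fin (E G) → Fin 3) → Set
IsTaitColouring G col = ∀ x c → endsOver G col c x ≡ 1

covering⇒tait : ∀ {G} (χ : CoveringProjection G (F 3 0)) → IsTaitColouring G (CoveringProjection.fE χ)
covering⇒tait χ x c = trans (endsOver-covering χ x c) (endsAt-F30 c (CoveringProjection.fV χ x))

tait⇒covering : ∀ {G} (col : Fin (E G) → Fin 3) → Fin (V G) → IsTaitColouring G col → CoveringProjection G (F 3 0)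
tait⇒covering {G} col x₀ tait =
  mkCovering G (F 3 0) (λ _ → 0F) col (λ { 0F → x₀ , refl })
    (λ e _ → cong isSemi (F30-semi (col e))) (λ e → ⊥-elim ∘ loopless e) (λ x c → trans (tait x c) (sym (endsAt-F30 c 0F)))
  where
  loopless : ∀ e → isLoop (ends G e) ≢ true
  loopless e is-loop with ends G e in eq
  ... | loop u = 2≰1 (subst₂ _≤_ two (tait u (col e)) (endsAt≤endsOver G col e u))
    where
    2≰1 : ¬ 2 ≤ 1
    2≰1 (s≤s ())
    two : endsAt (ends G e) u ≡ 2
    two rewrite eq | δ-refl u = refl

module _ (G : Graph) where

  endsAtOf : Fin (V G) → Fin (E G) → ℕ
  endsAtOf x h = endsAt (ends G h) x

  endEdge : ∀ x → Fin (sum (endsAtOf x)) → Fin (E G)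
  endEdge x = proj₁ ∘ split (endsAtOf x)

  sum-endEdge : ∀ x h → sum (λ s → δ (endEdge x s) h) ≡ endsAt (ends G h) x
  sum-endEdge x h = begin
    sum (λ s → δ (endEdge x s) h)                     ≡⟨ sum-split (endsAtOf x) (λ p → δ (proj₁ p) h) ⟩
    sum (λ h′ → sum {endsAtOf x h′} (λ _ → δ h′ h))   ≡⟨ sum-cong-≗ (λ h′ → trans (sum-const (endsAtOf x h′) (δ h′ h)) (*-comm (endsAtOf x h′) (δ h′ h))) ⟩
    sum (λ h′ → δ h′ h * endsAtOf x h′)               ≡⟨ sum-δˡ h (endsAtOf x) ⟩
    endsAt (ends G h) x                               ∎
    where open ≡-Reasoning

  Darts : ℕ
  Darts = sum (λ x → sum (endsAtOf x))

  dartVertex : Fin Darts → Fin (V G)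
  dartVertex t = proj₁ (split (λ x → sum (endsAtOf x)) t)

  dartEdge : Fin Darts → Fin (E G)
  dartEdge t = let (x , s) = split (λ x → sum (endsAtOf x)) t in endEdge x s

  sum-darts : ∀ x h → sum (λ t → δ (dartEdge t) h * δ (dartVertex t) x) ≡ endsAt (ends G h) x
  sum-darts x h = begin
    sum (λ t → δ (dartEdge t) h * δ (dartVertex t) x)
      ≡⟨ sum-split (λ x → sum (endsAtOf x)) (λ p → δ (endEdge (proj₁ p) (proj₂ p)) h * δ (proj₁ p) x) ⟩
    sum (λ x′ → sum (λ s → δ (endEdge x′ s) h * δ x′ x))
      ≡⟨ sum-cong-≗ (λ x′ → sym (*-distribʳ-sum (δ x′ x) (λ s → δ (endEdge x′ s) h))) ⟩
    sum (λ x′ → sum (λ s → δ (endEdge x′ s) h) * δ x′ x)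
      ≡⟨ sum-cong-≗ (λ x′ → trans (cong (_* δ x′ x) (sum-endEdge x′ h)) (*-comm _ (δ x′ x))) ⟩
    sum (λ x′ → δ x′ x * endsAt (ends G h) x′)
      ≡⟨ sum-δˡ x (λ x′ → endsAt (ends G h) x′) ⟩
    endsAt (ends G h) x ∎
    where open ≡-Reasoning

module _ (G : Graph) (cubic : Cubic G) where

  private
    3≡ends : ∀ x → 3 ≡ sum (endsAtOf G x)
    3≡ends x = trans (sym (cubic x)) (∑≡sum (E G) _)

  slot : Fin (V G) → Fin 3 → Fin (E G)
  slot x = endEdge G x ∘ cast (3≡ends x)

  sum-slot : ∀ x h → sum (λ m → δ (slot x m) h) ≡ endsAt (ends G h) x
  sum-slot x h = trans (sym (∑-permute (λ s → δ (endEdge G x s) h) (cast-id (3≡ends x)))) (sum-endEdge G x h)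

  slotOf : Fin (E G) → Fin 3
  slotOf h = cast (sym (3≡ends (source (ends G h)))) (merge (endsAtOf G (source (ends G h))) (h , fromℕ< (endsAt-source (ends G h))))

  slot-slotOf : ∀ h → slot (source (ends G h)) (slotOf h) ≡ h
  slot-slotOf h = trans (cong (proj₁ ∘ split (endsAtOf G x)) (cast-involutive (3≡ends x) (sym (3≡ends x)) _))
                        (cong proj₁ (split-merge (endsAtOf G x) _))
    where
    x : Fin (V G)
    x = source (ends G h)

-- Above each vertex of A lie two rows of N vertices, and the dart t joins them by the shift
-- i ↦ t + i (mod N).  Distinct darts shift by distinct amounts, so no two edges are parallel.
module SimpleCover (A : Graph) where

  N : ℕ
  N = suc (Darts A)

  open Rotation N

  dart<N : ∀ t → toℕ t < N
  dart<N t = s≤s (<⇒≤ (toℕ<n t))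

  vertex : Fin (V A) → Fin 2 → Fin N → Fin (V A * (2 * N))
  vertex x b i = combine x (combine b i)

  dartOf : Fin (Darts A * N) → Fin (Darts A)
  dartOf e = proj₁ (remQuot {Darts A} N e)

  offsetOf : Fin (Darts A * N) → Fin N
  offsetOf e = proj₂ (remQuot {Darts A} N e)

  src tgt : Fin (Darts A * N) → Fin (V A * (2 * N))
  src e = vertex (dartVertex A (dartOf e)) 0F (offsetOf e)
  tgt e = vertex (dartVertex A (dartOf e)) 1F (rotate (toℕ (dartOf e)) (offsetOf e))

  vertex-injective : ∀ x b i x′ b′ i′ → vertex x b i ≡ vertex x′ b′ i′ → x ≡ x′ × b ≡ b′ × i ≡ i′
  vertex-injective x b i x′ b′ i′ eq =
    let (x≡x′ , rest) = combine-injective x (combine b i) x′ (combine b′ i′) eq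
        (b≡b′ , i≡i′) = combine-injective b i b′ i′ rest
    in x≡x′ , b≡b′ , i≡i′

  src≢tgt : ∀ e → src e ≢ tgt e
  src≢tgt e eq with vertex-injective (dartVertex A (dartOf e)) 0F (offsetOf e) (dartVertex A (dartOf e)) 1F _ eq
  ... | _ , () , _

  cover : Graph
  cover = normals src tgt src≢tgt

  simple : Simple cover
  simple = normals-simple src tgt src≢tgt determined
    where
    determined : ∀ e e′ → (src e ≡ src e′ × tgt e ≡ tgt e′) ⊎ (src e ≡ tgt e′ × tgt e ≡ src e′) → e ≡ e′
    determined e e′ (inj₁ (src≡ , tgt≡)) = begin
      e                                ≡⟨ sym (combine-remQuot {Darts A} N e) ⟩
      combine (dartOf e) (offsetOf e)  ≡⟨ cong₂ combine t≡t′ i≡i′ ⟩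
      combine (dartOf e′) (offsetOf e′) ≡⟨ combine-remQuot {Darts A} N e′ ⟩
      e′                               ∎
      where
      open ≡-Reasoning
      i≡i′ : offsetOf e ≡ offsetOf e′
      i≡i′ = proj₂ (proj₂ (vertex-injective (dartVertex A (dartOf e)) 0F (offsetOf e) (dartVertex A (dartOf e′)) 0F (offsetOf e′) src≡))
      rotations≡ : rotate (toℕ (dartOf e)) (offsetOf e′) ≡ rotate (toℕ (dartOf e′)) (offsetOf e′)
      rotations≡ = trans (cong (rotate (toℕ (dartOf e))) (sym i≡i′))
                         (proj₂ (proj₂ (vertex-injective (dartVertex A (dartOf e)) 1F _ (dartVertex A (dartOf e′)) 1F _ tgt≡)))
      t≡t′ : dartOf e ≡ dartOf e′
      t≡t′ = toℕ-injective (rotate-injectiveˡ (offsetOf e′) (dart<N (dartOf e)) (dart<N (dartOf e′)) rotations≡)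
    determined e e′ (inj₂ (src≡tgt , _)) with vertex-injective (dartVertex A (dartOf e)) 0F (offsetOf e) (dartVertex A (dartOf e′)) 1F _ src≡tgt
    ... | _ , () , _

  fV : Fin (V A * (2 * N)) → Fin (V A)
  fV v = proj₁ (remQuot (2 * N) v)

  fE : Fin (Darts A * N) → Fin (E A)
  fE e = dartEdge A (dartOf e)

  sum-δ-rows : ∀ {k} → k ≤ N → ∀ b j → sum (λ i → δ 0F b * δ i j + δ 1F b * δ (rotate k i) j) ≡ 1
  sum-δ-rows {k} k≤N b j = begin
    sum (λ i → δ 0F b * δ i j + δ 1F b * δ (rotate k i) j)
      ≡⟨ ∑-distrib-+ (λ i → δ 0F b * δ i j) (λ i → δ 1F b * δ (rotate k i) j) ⟩
    sum (λ i → δ 0F b * δ i j) + sum (λ i → δ 1F b * δ (rotate k i) j)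
      ≡⟨ sym (cong₂ _+_ (*-distribˡ-sum (δ 0F b) (λ i → δ i j)) (*-distribˡ-sum (δ 1F b) (λ i → δ (rotate k i) j))) ⟩
    δ 0F b * sum (λ i → δ i j) + δ 1F b * sum (λ i → δ (rotate k i) j)
      ≡⟨ cong₂ (λ p q → δ 0F b * p + δ 1F b * q) (sum-δ j) (sum-δ-rotate k≤N j) ⟩
    δ 0F b * 1 + δ 1F b * 1
      ≡⟨ trans (cong₂ _+_ (*-identityʳ (δ 0F b)) (*-identityʳ (δ 1F b))) (δ₀+δ₁≡1 b) ⟩
    1 ∎
    where open ≡-Reasoning

  counts-vertex : ∀ x b j h → endsOver cover fE h (vertex x b j) ≡ endsAt (ends A h) x
  counts-vertex x b j h = begin
    endsOver cover fE h (vertex x b j)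
      ≡⟨ sum-remQuot (Darts A) N (λ (t , i) → δ (dartEdge A t) h * (δ (vertex (dartVertex A t) 0F i) (vertex x b j) + δ (vertex (dartVertex A t) 1F (rotate (toℕ t) i)) (vertex x b j))) ⟩
    sum (λ t → sum (λ i → δ (dartEdge A t) h * (δ (vertex (dartVertex A t) 0F i) (vertex x b j) + δ (vertex (dartVertex A t) 1F (rotate (toℕ t) i)) (vertex x b j))))
      ≡⟨ sum-cong-≗ (λ t → sum-cong-≗ (λ i → cong (δ (dartEdge A t) h *_) (cong₂ _+_ (δ-combine₃ (dartVertex A t) x 0F b i j) (δ-combine₃ (dartVertex A t) x 1F b (rotate (toℕ t) i) j)))) ⟩
    sum (λ t → sum (λ i → δ (dartEdge A t) h * (δ (dartVertex A t) x * (δ 0F b * δ i j) + δ (dartVertex A t) x * (δ 1F b * δ (rotate (toℕ t) i) j))))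
      ≡⟨ sum-cong-≗ onDart ⟩
    sum (λ t → δ (dartEdge A t) h * δ (dartVertex A t) x)
      ≡⟨ sum-darts A x h ⟩
    endsAt (ends A h) x ∎
    where
    open ≡-Reasoning
    factor : ∀ a c d₀ d₁ p q → a * (c * (d₀ * p) + c * (d₁ * q)) ≡ (a * c) * (d₀ * p + d₁ * q)
    factor = solve-∀
    onDart : ∀ t → sum (λ i → δ (dartEdge A t) h * (δ (dartVertex A t) x * (δ 0F b * δ i j) + δ (dartVertex A t) x * (δ 1F b * δ (rotate (toℕ t) i) j)))
                   ≡ δ (dartEdge A t) h * δ (dartVertex A t) x
    onDart t = begin
      sum (λ i → δ (dartEdge A t) h * (δ (dartVertex A t) x * (δ 0F b * δ i j) + δ (dartVertex A t) x * (δ 1F b * δ (rotate (toℕ t) i) j)))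
        ≡⟨ sum-cong-≗ (λ i → factor (δ (dartEdge A t) h) (δ (dartVertex A t) x) (δ 0F b) (δ 1F b) (δ i j) (δ (rotate (toℕ t) i) j)) ⟩
      sum (λ i → (δ (dartEdge A t) h * δ (dartVertex A t) x) * (δ 0F b * δ i j + δ 1F b * δ (rotate (toℕ t) i) j))
        ≡⟨ sym (*-distribˡ-sum (δ (dartEdge A t) h * δ (dartVertex A t) x) (λ i → δ 0F b * δ i j + δ 1F b * δ (rotate (toℕ t) i) j)) ⟩
      (δ (dartEdge A t) h * δ (dartVertex A t) x) * sum (λ i → δ 0F b * δ i j + δ 1F b * δ (rotate (toℕ t) i) j)
        ≡⟨ cong (δ (dartEdge A t) h * δ (dartVertex A t) x *_) (sum-δ-rows (<⇒≤ (dart<N t)) b j) ⟩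
      (δ (dartEdge A t) h * δ (dartVertex A t) x) * 1
        ≡⟨ *-identityʳ _ ⟩
      δ (dartEdge A t) h * δ (dartVertex A t) x ∎

  covering : CoveringProjection cover A
  covering = normals-covering src tgt src≢tgt A fV fE (λ x → vertex x 0F 0F , fV-vertex x 0F 0F) counts
    where
    fV-vertex : ∀ x b j → fV (vertex x b j) ≡ x
    fV-vertex x b j = cong proj₁ (remQuot-combine x (combine b j))
    counts : ∀ v h → endsOver cover fE h v ≡ endsAt (ends A h) (fV v)
    counts = combine-elim _ λ x → combine-elim _ λ b j h →
      trans (counts-vertex x b j h) (cong (endsAt (ends A h)) (sym (fV-vertex x b j)))

-- A double cover without semi-edges

copies : ∀ {n} → Edge n → ℕ
copies (normal _ _ _) = 2
copies (loop _)       = 2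
copies (semi _)       = 1

lift : ∀ {n} (e : Edge n) → Fin (copies e) → Edge (n * 2)
lift (normal u v u≢v) c = normal (combine u c) (combine v c) (u≢v ∘ proj₁ ∘ combine-injective u c v c)
lift (loop u)         c = loop (combine u c)
lift (semi u)         _ = normal (combine u 0F) (combine u 1F) (0≢1+n ∘ proj₂ ∘ combine-injective u 0F u 1F)

firstCopy : ∀ {n} (e : Edge n) → Fin (copies e)
firstCopy (normal _ _ _) = 0F
firstCopy (loop _)       = 0F
firstCopy (semi _)       = 0F

private
  δ-pair : ∀ {n} (u v x : Fin n) (c b : Fin 2) →
           δ (combine u c) (combine x b) + δ (combine v c) (combine x b) ≡ δ c b * (δ u x + δ v x)
  δ-pair u v x c b = begin
    δ (combine u c) (combine x b) + δ (combine v c) (combine x b) ≡⟨ cong₂ _+_ (δ-combine u x c b) (δ-combine v x c b) ⟩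
    δ u x * δ c b + δ v x * δ c b                                 ≡⟨ sym (*-distribʳ-+ (δ c b) (δ u x) (δ v x)) ⟩
    (δ u x + δ v x) * δ c b                                       ≡⟨ *-comm (δ u x + δ v x) (δ c b) ⟩
    δ c b * (δ u x + δ v x)                                       ∎
    where open ≡-Reasoning

sum-endsAt-lift : ∀ {n} (e : Edge n) x b → sum (λ c → endsAt (lift e c) (combine x b)) ≡ endsAt e x
sum-endsAt-lift (normal u v _) x b = trans (sum-cong-≗ (λ c → δ-pair u v x c b)) (sum-δˡ b (λ _ → δ u x + δ v x))
sum-endsAt-lift (loop u)       x b = trans (sum-cong-≗ (λ c → δ-pair u u x c b)) (sum-δˡ b (λ _ → δ u x + δ u x))
sum-endsAt-lift (semi u)       x b = begin
  δ (combine u 0F) (combine x b) + δ (combine u 1F) (combine x b) + 0 ≡⟨ +-identityʳ _ ⟩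
  δ (combine u 0F) (combine x b) + δ (combine u 1F) (combine x b)     ≡⟨ cong₂ _+_ (δ-combine u x 0F b) (δ-combine u x 1F b) ⟩
  δ u x * δ 0F b + δ u x * δ 1F b                                      ≡⟨ sym (*-distribˡ-+ (δ u x) (δ 0F b) (δ 1F b)) ⟩
  δ u x * (δ 0F b + δ 1F b)                                            ≡⟨ cong (δ u x *_) (δ₀+δ₁≡1 b) ⟩
  δ u x * 1                                                            ≡⟨ *-identityʳ (δ u x) ⟩
  δ u x                                                                ∎
  where open ≡-Reasoning

endsAt-lift-firstSheet : ∀ {n} (e : Edge n) x c → endsAt (lift e c) (combine x 0F) ≡ δ c (firstCopy e) * endsAt e x
endsAt-lift-firstSheet (normal u v _) x c = δ-pair u v x c 0F
endsAt-lift-firstSheet (loop u)       x c = δ-pair u u x c 0F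
endsAt-lift-firstSheet (semi u)       x 0F = begin
  δ (combine u 0F) (combine x 0F) + δ (combine u 1F) (combine x 0F) ≡⟨ cong₂ _+_ (δ-combine u x 0F 0F) (δ-combine u x 1F 0F) ⟩
  δ u x * 1 + δ u x * 0                                             ≡⟨ cong₂ _+_ (*-identityʳ (δ u x)) (*-zeroʳ (δ u x)) ⟩
  δ u x + 0                                                         ∎
  where open ≡-Reasoning

lift-nonSemi : ∀ {n} (e : Edge n) c → isSemi (lift e c) ≡ false
lift-nonSemi (normal _ _ _) _ = refl
lift-nonSemi (loop _)       _ = refl
lift-nonSemi (semi _)       _ = refl

lift-loop : ∀ {n} (e : Edge n) c → isLoop (lift e c) ≡ true → isLoop e ≡ true
lift-loop (loop _) _ _ = refl

module DoubleCover (A : Graph) where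

  copiesOf : Fin (E A) → ℕ
  copiesOf h = copies (ends A h)

  double : Graph
  double = graph (V A * 2) (sum copiesOf) λ e → let (h , c) = split copiesOf e in lift (ends A h) c

  fV : Fin (V A * 2) → Fin (V A)
  fV v = proj₁ (remQuot 2 v)

  fE : Fin (sum copiesOf) → Fin (E A)
  fE e = proj₁ (split copiesOf e)

  semiFree : ∀ e → isSemi (ends double e) ≡ false
  semiFree e = lift-nonSemi (ends A (fE e)) _

  counts-vertex : ∀ x b h → endsOver double fE h (combine x b) ≡ endsAt (ends A h) x
  counts-vertex x b h = begin
    endsOver double fE h (combine x b)
      ≡⟨ sum-split copiesOf (λ (h′ , c) → δ h′ h * endsAt (lift (ends A h′) c) (combine x b)) ⟩
    sum (λ h′ → sum (λ c → δ h′ h * endsAt (lift (ends A h′) c) (combine x b)))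
      ≡⟨ sum-cong-≗ (λ h′ → sym (*-distribˡ-sum (δ h′ h) (λ c → endsAt (lift (ends A h′) c) (combine x b)))) ⟩
    sum (λ h′ → δ h′ h * sum (λ c → endsAt (lift (ends A h′) c) (combine x b)))
      ≡⟨ sum-cong-≗ (λ h′ → cong (δ h′ h *_) (sum-endsAt-lift (ends A h′) x b)) ⟩
    sum (λ h′ → δ h′ h * endsAt (ends A h′) x)
      ≡⟨ sum-δˡ h (λ h′ → endsAt (ends A h′) x) ⟩
    endsAt (ends A h) x ∎
    where open ≡-Reasoning

  covering : CoveringProjection double A
  covering = mkCovering double A fV fE (λ x → combine x 0F , fV-combine x 0F)
    (λ e is-semi → ⊥-elim (true≢false (trans (sym is-semi) (semiFree e))))
    (λ e → lift-loop (ends A (fE e)) _)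
    (combine-elim _ λ x b h → trans (counts-vertex x b h) (cong (endsAt (ends A h)) (sym (fV-combine x b))))
    where
    fV-combine : ∀ x b → fV (combine x b) ≡ x
    fV-combine x b = cong proj₁ (remQuot-combine x b)
    true≢false : true ≢ false
    true≢false ()

  cubic : Cubic A → Cubic double
  cubic A-cubic v = trans (CoveringProjection.degree covering v) (A-cubic (fV v))

  sheetColouring : (Fin (sum copiesOf) → Fin 3) → Fin (E A) → Fin 3
  sheetColouring col h = col (merge copiesOf (h , firstCopy (ends A h)))

  tait-descends : ∀ col → IsTaitColouring double col → IsTaitColouring A (sheetColouring col)
  tait-descends col tait x c = begin
    endsOver A (sheetColouring col) c x
      ≡⟨ sum-cong-≗ onEdge ⟨
    sum (λ h → sum (λ d → δ (col (merge copiesOf (h , d))) c * endsAt (lift (ends A h) d) (combine x 0F)))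
      ≡⟨ sum-split copiesOf (λ p → δ (col (merge copiesOf p)) c * endsAt (lift (ends A (proj₁ p)) (proj₂ p)) (combine x 0F)) ⟨
    sum (λ e → δ (col (merge copiesOf (split copiesOf e))) c * endsAt (ends double e) (combine x 0F))
      ≡⟨ sum-cong-≗ (λ e → cong (λ e′ → δ (col e′) c * endsAt (ends double e) (combine x 0F)) (merge-split copiesOf e)) ⟩
    endsOver double col c (combine x 0F)
      ≡⟨ tait (combine x 0F) c ⟩
    1 ∎
    where
    open ≡-Reasoning
    onEdge : ∀ h → sum (λ d → δ (col (merge copiesOf (h , d))) c * endsAt (lift (ends A h) d) (combine x 0F))
                   ≡ δ (sheetColouring col h) c * endsAt (ends A h) x
    onEdge h = begin
      sum (λ d → δ (col (merge copiesOf (h , d))) c * endsAt (lift (ends A h) d) (combine x 0F))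
        ≡⟨ sum-cong-≗ (λ d → cong (δ (col (merge copiesOf (h , d))) c *_) (endsAt-lift-firstSheet (ends A h) x d)) ⟩
      sum (λ d → δ (col (merge copiesOf (h , d))) c * (δ d (firstCopy (ends A h)) * endsAt (ends A h) x))
        ≡⟨ sum-cong-≗ (λ d → x∙yz≈y∙xz (δ (col (merge copiesOf (h , d))) c) (δ d (firstCopy (ends A h))) (endsAt (ends A h) x)) ⟩
      sum (λ d → δ d (firstCopy (ends A h)) * (δ (col (merge copiesOf (h , d))) c * endsAt (ends A h) x))
        ≡⟨ sum-δˡ (firstCopy (ends A h)) (λ d → δ (col (merge copiesOf (h , d))) c * endsAt (ends A h) x) ⟩
      δ (sheetColouring col h) c * endsAt (ends A h) x ∎

-- The gadget

-- K₃,₃ on the internal vertices 0,1,2 | 3,4,5 with the edge 0–3 cut into two pendant edges.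
-- Edges are listed as (source , target) with an internal target; sources number the two terminals
-- 0 and 1 and the internal vertex u as 2 + u.
gadgetEdge : Fin 10 → Fin 8 × Fin 6
gadgetEdge = lookup ((0F , 0F) ∷ (1F , 3F) ∷ (2F , 4F) ∷ (2F , 5F) ∷ (3F , 3F) ∷ (3F , 4F) ∷ (3F , 5F) ∷ (4F , 3F) ∷ (4F , 4F) ∷ (4F , 5F) ∷ [])

gadgetEndsAt : Fin 10 → Fin 8 → ℕ
gadgetEndsAt k v = δ (proj₁ (gadgetEdge k)) v + δ (Fin.suc (Fin.suc (proj₂ (gadgetEdge k)))) v

gadgetDegree : Fin 8 → ℕ
gadgetDegree 0F                    = 1
gadgetDegree 1F                    = 1
gadgetDegree (Fin.suc (Fin.suc _)) = 3

gadgetPorts : (v : Fin 8) → Fin (gadgetDegree v) → Fin 10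
gadgetPorts 0F                    _ = 0F
gadgetPorts 1F                    _ = 1F
gadgetPorts (Fin.suc (Fin.suc u)) = lookup (lookup ((0F ∷ 2F ∷ 3F ∷ []) ∷ (6F ∷ 4F ∷ 5F ∷ []) ∷ (8F ∷ 9F ∷ 7F ∷ []) ∷
                                                    (1F ∷ 4F ∷ 7F ∷ []) ∷ (8F ∷ 2F ∷ 5F ∷ []) ∷ (6F ∷ 9F ∷ 3F ∷ []) ∷ []) u)

gadgetPort : Fin 6 → Fin 3 → Fin 10
gadgetPort u = gadgetPorts (Fin.suc (Fin.suc u))

-- The edge between internal vertices i and 3 + j gets slot i + j (mod 3), the pendant edges slot 0.
gadgetSlot : Fin 10 → Fin 3
gadgetSlot = lookup (0F ∷ 0F ∷ 1F ∷ 2F ∷ 1F ∷ 2F ∷ 0F ∷ 2F ∷ 0F ∷ 1F ∷ [])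

gadget-incidence : ∀ v k → gadgetEndsAt k v ≡ sum (λ m → δ (gadgetPorts v m) k)
gadget-incidence = from-yes (all? λ v → all? λ k → gadgetEndsAt k v ≟ sum (λ m → δ (gadgetPorts v m) k))

gadgetSlot-port : ∀ u m → gadgetSlot (gadgetPort u m) ≡ m
gadgetSlot-port = from-yes (all? λ u → all? λ m → gadgetSlot (gadgetPort u m) ≟F m)

gadget-loopless : ∀ k → proj₁ (gadgetEdge k) ≢ Fin.suc (Fin.suc (proj₂ (gadgetEdge k)))
gadget-loopless = from-yes (all? λ k → ¬? (proj₁ (gadgetEdge k) ≟F Fin.suc (Fin.suc (proj₂ (gadgetEdge k)))))

interior : Fin 8 → Maybe (Fin 6)
interior 0F                    = nothing
interior 1F                    = nothing
interior (Fin.suc (Fin.suc u)) = just u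

gadgetEdgeBetween : Maybe (Fin 6) → Maybe (Fin 6) → Maybe (Fin 10)
gadgetEdgeBetween a b = Maybe.map proj₁ (dec⇒maybe (any? joins?))
  where
  _≟M_ : ∀ (x y : Maybe (Fin 6)) → Dec (x ≡ y)
  _≟M_ = Maybe.≡-dec _≟F_
  joins? : ∀ k → Dec ((interior (proj₁ (gadgetEdge k)) ≡ a × just (proj₂ (gadgetEdge k)) ≡ b) ⊎
                      (interior (proj₁ (gadgetEdge k)) ≡ b × just (proj₂ (gadgetEdge k)) ≡ a))
  joins? k = (interior (proj₁ (gadgetEdge k)) ≟M a ×-dec just (proj₂ (gadgetEdge k)) ≟M b) ⊎-dec
             (interior (proj₁ (gadgetEdge k)) ≟M b ×-dec just (proj₂ (gadgetEdge k)) ≟M a)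

gadgetEdgeBetween-ends : ∀ k → gadgetEdgeBetween (interior (proj₁ (gadgetEdge k))) (just (proj₂ (gadgetEdge k))) ≡ just k
gadgetEdgeBetween-ends = from-yes (all? λ k → Maybe.≡-dec _≟F_ (gadgetEdgeBetween (interior (proj₁ (gadgetEdge k))) (just (proj₂ (gadgetEdge k)))) (just k))

gadgetEdgeBetween-ends′ : ∀ k → gadgetEdgeBetween (just (proj₂ (gadgetEdge k))) (interior (proj₁ (gadgetEdge k))) ≡ just k
gadgetEdgeBetween-ends′ = from-yes (all? λ k → Maybe.≡-dec _≟F_ (gadgetEdgeBetween (just (proj₂ (gadgetEdge k))) (interior (proj₁ (gadgetEdge k)))) (just k))

gadget-handshake : ∀ (w : Fin 10 → ℕ) → sum (λ v → sum (w ∘ gadgetPorts v)) ≡ 2 * sum w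
gadget-handshake w = begin
  sum (λ v → sum (w ∘ gadgetPorts v))                ≡⟨ sum-cong-≗ (λ v → sum-incidence w (λ k → gadgetEndsAt k v) (gadgetPorts v) (gadget-incidence v)) ⟨
  sum (λ v → sum (λ k → w k * gadgetEndsAt k v))     ≡⟨ ∑-comm (λ v k → w k * gadgetEndsAt k v) ⟩
  sum (λ k → sum (λ v → w k * gadgetEndsAt k v))     ≡⟨ sum-cong-≗ (λ k → trans (sym (*-distribˡ-sum (w k) (gadgetEndsAt k))) (cong (w k *_) (two-ends k))) ⟩
  sum (λ k → w k * 2)                                ≡⟨ sum-cong-≗ (λ k → *-comm (w k) 2) ⟩
  sum (λ k → 2 * w k)                                ≡⟨ *-distribˡ-sum 2 w ⟨
  2 * sum w                                          ∎
  where
  open ≡-Reasoning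
  two-ends : ∀ k → sum (gadgetEndsAt k) ≡ 2
  two-ends k = trans (∑-distrib-+ (δ (proj₁ (gadgetEdge k))) (δ (Fin.suc (Fin.suc (proj₂ (gadgetEdge k))))))
                     (cong₂ _+_ (sum-δ′ (proj₁ (gadgetEdge k))) (sum-δ′ (Fin.suc (Fin.suc (proj₂ (gadgetEdge k))))))

-- Parity lemma: the edges of one colour meet each of the six internal vertices once, so by
-- gadget-handshake an even number of the two pendant edges have that colour.
gadget-forcing : ∀ (col : Fin 10 → Fin 3) → (∀ u c → sum (λ m → δ (col (gadgetPort u m)) c) ≡ 1) → col 1F ≡ col 0F
gadget-forcing col tait with col 1F ≟F col 0F
... | yes same = same
... | no differ = ⊥-elim (even≢odd (sum w) 3 (sym seven≡))
  where
  w : Fin 10 → ℕ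
  w k = δ (col k) (col 0F)
  seven≡ : 7 ≡ 2 * sum w
  seven≡ = begin
    7                                                                        ≡⟨ cong₂ (λ a b → (a + 0) + ((b + 0) + 6 * 1)) (δ-refl (col 0F)) (δ-≢ differ) ⟨
    (w 0F + 0) + ((w 1F + 0) + 6 * 1)                                        ≡⟨ cong (λ s → (w 0F + 0) + ((w 1F + 0) + s)) (trans (sum-cong-≗ (λ u → tait u (col 0F))) (sum-const 6 1)) ⟨
    (w 0F + 0) + ((w 1F + 0) + sum (λ u → sum (w ∘ gadgetPort u)))           ≡⟨ gadget-handshake w ⟩
    2 * sum w                                                                ∎
    where open ≡-Reasoning

-- A covering projection need only be a local bijection on edge-neighbourhoods: the gadget replacing
-- an edge h lies over the source of h, its edges labelled by the three edges there (σ h), both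
-- pendant edges by h itself.
module GadgetReplacement (B : Graph) (cubic : Cubic B) (semiFree : ∀ h → isSemi (ends B h) ≡ false) where

  open Rotation 3

  Vertex : Set
  Vertex = Fin (V B) ⊎ (Fin (E B) × Fin 6)

  encode : Vertex → Fin (V B + E B * 6)
  encode = join (V B) (E B * 6) ∘ Sum.map₂ (uncurry (combine {E B} {6}))

  decode : Fin (V B + E B * 6) → Vertex
  decode = Sum.map₂ (remQuot 6) ∘ splitAt (V B)

  decode-encode : ∀ x → decode (encode x) ≡ x
  decode-encode (inj₁ p)       = cong (Sum.map₂ (remQuot 6)) (splitAt-join (V B) (E B * 6) (inj₁ p))
  decode-encode (inj₂ (h , u)) = trans (cong (Sum.map₂ (remQuot 6)) (splitAt-join (V B) (E B * 6) (inj₂ (combine h u))))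
                                       (cong inj₂ (remQuot-combine h u))

  encode-decode : ∀ v → encode (decode v) ≡ v
  encode-decode v = trans (cong (join (V B) (E B * 6)) (reassemble (splitAt (V B) v))) (join-splitAt (V B) (E B * 6) v)
    where
    reassemble : ∀ (y : Fin (V B) ⊎ Fin (E B * 6)) → Sum.map₂ (uncurry (combine {E B} {6})) (Sum.map₂ (remQuot 6) y) ≡ y
    reassemble (inj₁ p) = refl
    reassemble (inj₂ c) = cong inj₂ (combine-remQuot {E B} 6 c)

  port : Fin (V B) → Fin (V B + E B * 6)
  port p = encode (inj₁ p)

  inner : Fin (E B) → Fin 6 → Fin (V B + E B * 6)
  inner h u = encode (inj₂ (h , u))

  vertex-elim : ∀ (P : Fin (V B + E B * 6) → Set) → (∀ p → P (port p)) → (∀ h u → P (inner h u)) → ∀ v → P v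
  vertex-elim P onPort onInner v = subst P (encode-decode v) (onDecoded (decode v))
    where
    onDecoded : ∀ x → P (encode x)
    onDecoded (inj₁ p)       = onPort p
    onDecoded (inj₂ (h , u)) = onInner h u

  placed : Fin (E B) → Fin 8 → Vertex
  placed h 0F                    = inj₁ (source (ends B h))
  placed h 1F                    = inj₁ (target (ends B h))
  placed h (Fin.suc (Fin.suc u)) = inj₂ (h , u)

  unitOf : Fin (E B * 10) → Fin (E B)
  unitOf e = proj₁ (remQuot {E B} 10 e)

  pieceOf : Fin (E B * 10) → Fin 10
  pieceOf e = proj₂ (remQuot {E B} 10 e)

  src tgt : Fin (E B * 10) → Fin (V B + E B * 6)
  src e = encode (placed (unitOf e) (proj₁ (gadgetEdge (pieceOf e))))
  tgt e = inner (unitOf e) (proj₂ (gadgetEdge (pieceOf e)))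

  src≢tgt : ∀ e → src e ≢ tgt e
  src≢tgt e eq = gadget-loopless (pieceOf e) (placed-inner (proj₁ (gadgetEdge (pieceOf e))) (trans (sym (decode-encode _)) (trans (cong decode eq) (decode-encode _))))
    where
    placed-inner : ∀ {h u} a → placed h a ≡ inj₂ (h , u) → a ≡ Fin.suc (Fin.suc u)
    placed-inner (Fin.suc (Fin.suc u′)) refl = refl

  replaced : Graph
  replaced = normals src tgt src≢tgt

  δ-placed-inner : ∀ h a h′ u → δ (encode (placed h a)) (inner h′ u) ≡ δ h h′ * δ a (Fin.suc (Fin.suc u))
  δ-placed-inner h 0F                     h′ u = trans (δ-↑ˡ↑ʳ (source (ends B h)) (combine h′ u)) (sym (*-zeroʳ (δ h h′)))
  δ-placed-inner h 1F                     h′ u = trans (δ-↑ˡ↑ʳ (target (ends B h)) (combine h′ u)) (sym (*-zeroʳ (δ h h′)))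
  δ-placed-inner h (Fin.suc (Fin.suc u′)) h′ u =
    trans (δ-injective (V B ↑ʳ_) (λ {i} {j} → ↑ʳ-injective (V B) i j) (combine h u′) (combine h′ u)) (δ-combine h h′ u′ u)

  δ-placed-port : ∀ h a p → δ (encode (placed h a)) (port p) ≡ δ a 0F * δ (source (ends B h)) p + δ a 1F * δ (target (ends B h)) p
  δ-placed-port h 0F                    p = trans (δ-injective (_↑ˡ E B * 6) (λ {i} {j} → ↑ˡ-injective (E B * 6) i j) (source (ends B h)) p)
                                                  (sym (trans (+-identityʳ _) (+-identityʳ (δ (source (ends B h)) p))))
  δ-placed-port h 1F                    p = trans (δ-injective (_↑ˡ E B * 6) (λ {i} {j} → ↑ˡ-injective (E B * 6) i j) (target (ends B h)) p)
                                                  (sym (+-identityʳ (δ (target (ends B h)) p)))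
  δ-placed-port h (Fin.suc (Fin.suc u)) p = trans (δ-sym (inner h u) (port p)) (δ-↑ˡ↑ʳ p (combine h u))

  weightedDegree-split : ∀ w v → weightedDegree replaced w v ≡
    sum (λ h → sum (λ k → w (combine h k) * (δ (encode (placed h (proj₁ (gadgetEdge k)))) v + δ (inner h (proj₂ (gadgetEdge k))) v)))
  weightedDegree-split w v =
    trans (sum-cong-≗ (λ e → cong (λ e′ → w e′ * (δ (src e) v + δ (tgt e) v)) (sym (combine-remQuot {E B} 10 e))))
          (sum-remQuot (E B) 10 (λ (h , k) → w (combine h k) * (δ (encode (placed h (proj₁ (gadgetEdge k)))) v + δ (inner h (proj₂ (gadgetEdge k))) v)))

  weightedDegree-inner : ∀ w h′ u → weightedDegree replaced w (inner h′ u) ≡ sum (λ m → w (combine h′ (gadgetPort u m)))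
  weightedDegree-inner w h′ u = begin
    weightedDegree replaced w (inner h′ u)
      ≡⟨ weightedDegree-split w (inner h′ u) ⟩
    sum (λ h → sum (λ k → w (combine h k) * (δ (encode (placed h (proj₁ (gadgetEdge k)))) (inner h′ u) + δ (inner h (proj₂ (gadgetEdge k))) (inner h′ u))))
      ≡⟨ sum-cong-≗ (λ h → sum-cong-≗ (λ k → onPiece h k)) ⟩
    sum (λ h → sum (λ k → δ h h′ * (w (combine h k) * gadgetEndsAt k (Fin.suc (Fin.suc u)))))
      ≡⟨ sum-cong-≗ (λ h → *-distribˡ-sum (δ h h′) (λ k → w (combine h k) * gadgetEndsAt k (Fin.suc (Fin.suc u)))) ⟨
    sum (λ h → δ h h′ * sum (λ k → w (combine h k) * gadgetEndsAt k (Fin.suc (Fin.suc u))))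
      ≡⟨ sum-δˡ h′ (λ h → sum (λ k → w (combine h k) * gadgetEndsAt k (Fin.suc (Fin.suc u)))) ⟩
    sum (λ k → w (combine h′ k) * gadgetEndsAt k (Fin.suc (Fin.suc u)))
      ≡⟨ sum-incidence (w ∘ combine h′) (λ k → gadgetEndsAt k (Fin.suc (Fin.suc u))) (gadgetPort u) (gadget-incidence (Fin.suc (Fin.suc u))) ⟩
    sum (λ m → w (combine h′ (gadgetPort u m))) ∎
    where
    open ≡-Reasoning
    factor : ∀ x d a b → x * (d * a + d * b) ≡ d * (x * (a + b))
    factor = solve-∀
    onPiece : ∀ h k → w (combine h k) * (δ (encode (placed h (proj₁ (gadgetEdge k)))) (inner h′ u) + δ (inner h (proj₂ (gadgetEdge k))) (inner h′ u))
                      ≡ δ h h′ * (w (combine h k) * gadgetEndsAt k (Fin.suc (Fin.suc u)))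
    onPiece h k = trans (cong (w (combine h k) *_) (cong₂ _+_ (δ-placed-inner h a h′ u) (δ-placed-inner h b h′ u)))
                        (factor (w (combine h k)) (δ h h′) (δ a (Fin.suc (Fin.suc u))) (δ b (Fin.suc (Fin.suc u))))
      where
      a b : Fin 8
      a = proj₁ (gadgetEdge k)
      b = Fin.suc (Fin.suc (proj₂ (gadgetEdge k)))

  weightedDegree-port : ∀ w p → weightedDegree replaced w (port p) ≡
    sum (λ h → δ (source (ends B h)) p * w (combine h 0F) + δ (target (ends B h)) p * w (combine h 1F))
  weightedDegree-port w p = trans (weightedDegree-split w (port p)) (sum-cong-≗ onUnit)
    where
    open ≡-Reasoning
    factor : ∀ x a₀ a₁ b₀ b₁ s t → x * ((a₀ * s + a₁ * t) + (b₀ * s + b₁ * t)) ≡ s * (x * (a₀ + b₀)) + t * (x * (a₁ + b₁))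
    factor = solve-∀
    onUnit : ∀ h → sum (λ k → w (combine h k) * (δ (encode (placed h (proj₁ (gadgetEdge k)))) (port p) + δ (inner h (proj₂ (gadgetEdge k))) (port p)))
                   ≡ δ (source (ends B h)) p * w (combine h 0F) + δ (target (ends B h)) p * w (combine h 1F)
    onUnit h = begin
      sum (λ k → w (combine h k) * (δ (encode (placed h (proj₁ (gadgetEdge k)))) (port p) + δ (inner h (proj₂ (gadgetEdge k))) (port p)))
        ≡⟨ sum-cong-≗ onPiece ⟩
      sum (λ k → S * (w (combine h k) * gadgetEndsAt k 0F) + T * (w (combine h k) * gadgetEndsAt k 1F))
        ≡⟨ ∑-distrib-+ (λ k → S * (w (combine h k) * gadgetEndsAt k 0F)) (λ k → T * (w (combine h k) * gadgetEndsAt k 1F)) ⟩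
      sum (λ k → S * (w (combine h k) * gadgetEndsAt k 0F)) + sum (λ k → T * (w (combine h k) * gadgetEndsAt k 1F))
        ≡⟨ cong₂ _+_ (*-distribˡ-sum S (λ k → w (combine h k) * gadgetEndsAt k 0F)) (*-distribˡ-sum T (λ k → w (combine h k) * gadgetEndsAt k 1F)) ⟨
      S * sum (λ k → w (combine h k) * gadgetEndsAt k 0F) + T * sum (λ k → w (combine h k) * gadgetEndsAt k 1F)
        ≡⟨ cong₂ (λ a b → S * a + T * b) (terminal 0F) (terminal 1F) ⟩
      S * (w (combine h 0F) + 0) + T * (w (combine h 1F) + 0)
        ≡⟨ cong₂ (λ a b → S * a + T * b) (+-identityʳ (w (combine h 0F))) (+-identityʳ (w (combine h 1F))) ⟩
      S * w (combine h 0F) + T * w (combine h 1F) ∎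
      where
      S T : ℕ
      S = δ (source (ends B h)) p
      T = δ (target (ends B h)) p
      onPiece : ∀ k → w (combine h k) * (δ (encode (placed h (proj₁ (gadgetEdge k)))) (port p) + δ (inner h (proj₂ (gadgetEdge k))) (port p))
                      ≡ S * (w (combine h k) * gadgetEndsAt k 0F) + T * (w (combine h k) * gadgetEndsAt k 1F)
      onPiece k = trans (cong (w (combine h k) *_) (cong₂ _+_ (δ-placed-port h a p) (δ-placed-port h b p)))
                        (factor (w (combine h k)) (δ a 0F) (δ a 1F) (δ b 0F) (δ b 1F) S T)
        where
        a b : Fin 8
        a = proj₁ (gadgetEdge k)
        b = Fin.suc (Fin.suc (proj₂ (gadgetEdge k)))
      terminal : ∀ a → sum (λ k → w (combine h k) * gadgetEndsAt k a) ≡ sum (λ m → w (combine h (gadgetPorts a m)))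
      terminal a = sum-incidence (w ∘ combine h) (λ k → gadgetEndsAt k a) (gadgetPorts a) (gadget-incidence a)

  σ : Fin (E B) → Fin 3 → Fin (E B)
  σ h m = slot B cubic (source (ends B h)) (rotate (toℕ (slotOf B cubic h)) m)

  σ-0 : ∀ h → σ h 0F ≡ h
  σ-0 h = trans (cong (slot B cubic (source (ends B h))) rotate-0) (slot-slotOf B cubic h)
    where
    rotate-0 : rotate (toℕ (slotOf B cubic h)) 0F ≡ slotOf B cubic h
    rotate-0 = toℕ-injective (trans (toℕ-rotate (toℕ (slotOf B cubic h)) 0F)
                                    (trans (cong (_% 3) (+-identityʳ (toℕ (slotOf B cubic h)))) (m<n⇒m%n≡m (toℕ<n (slotOf B cubic h)))))

  sum-σ : ∀ h h′ → sum (λ m → δ (σ h m) h′) ≡ endsAt (ends B h′) (source (ends B h))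
  sum-σ h h′ = trans (sum-rotate (<⇒≤ (toℕ<n (slotOf B cubic h))) (λ m → δ (slot B cubic (source (ends B h)) m) h′))
                     (sum-slot B cubic (source (ends B h)) h′)

  fV : Fin (V B + E B * 6) → Fin (V B)
  fV v = [ id , (λ (h , _) → source (ends B h)) ]′ (decode v)

  fE : Fin (E B * 10) → Fin (E B)
  fE e = σ (unitOf e) (gadgetSlot (pieceOf e))

  fE-combine : ∀ h k → fE (combine h k) ≡ σ h (gadgetSlot k)
  fE-combine h k = cong (λ (h′ , k′) → σ h′ (gadgetSlot k′)) (remQuot-combine h k)

  counts-inner : ∀ h u h′ → endsOver replaced fE h′ (inner h u) ≡ endsAt (ends B h′) (source (ends B h))
  counts-inner h u h′ = begin
    endsOver replaced fE h′ (inner h u)                   ≡⟨ weightedDegree-inner (λ e → δ (fE e) h′) h u ⟩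
    sum (λ m → δ (fE (combine h (gadgetPort u m))) h′)    ≡⟨ sum-cong-≗ (λ m → cong (λ x → δ x h′) (trans (fE-combine h (gadgetPort u m)) (cong (σ h) (gadgetSlot-port u m)))) ⟩
    sum (λ m → δ (σ h m) h′)                              ≡⟨ sum-σ h h′ ⟩
    endsAt (ends B h′) (source (ends B h))                ∎
    where open ≡-Reasoning

  counts-port : ∀ p h′ → endsOver replaced fE h′ (port p) ≡ endsAt (ends B h′) p
  counts-port p h′ = begin
    endsOver replaced fE h′ (port p)
      ≡⟨ weightedDegree-port (λ e → δ (fE e) h′) p ⟩
    sum (λ h → δ (source (ends B h)) p * δ (fE (combine h 0F)) h′ + δ (target (ends B h)) p * δ (fE (combine h 1F)) h′)
      ≡⟨ sum-cong-≗ (λ h → cong₂ (λ a b → δ (source (ends B h)) p * δ a h′ + δ (target (ends B h)) p * δ b h′)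
                                  (trans (fE-combine h 0F) (σ-0 h)) (trans (fE-combine h 1F) (σ-0 h))) ⟩
    sum (λ h → δ (source (ends B h)) p * δ h h′ + δ (target (ends B h)) p * δ h h′)
      ≡⟨ sum-cong-≗ (λ h → trans (sym (*-distribʳ-+ (δ h h′) (δ (source (ends B h)) p) _)) (*-comm _ (δ h h′))) ⟩
    sum (λ h → δ h h′ * (δ (source (ends B h)) p + δ (target (ends B h)) p))
      ≡⟨ sum-δˡ h′ (λ h → δ (source (ends B h)) p + δ (target (ends B h)) p) ⟩
    δ (source (ends B h′)) p + δ (target (ends B h′)) p
      ≡⟨ endsAt-nonSemi (ends B h′) p (semiFree h′) ⟨
    endsAt (ends B h′) p ∎
    where open ≡-Reasoning

  covering : CoveringProjection replaced B
  covering = normals-covering src tgt src≢tgt B fV fE (λ p → port p , fV-port p)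
               (vertex-elim _ (λ p h′ → trans (counts-port p h′) (cong (endsAt (ends B h′)) (sym (fV-port p))))
                              (λ h u h′ → trans (counts-inner h u h′) (cong (endsAt (ends B h′)) (sym (fV-inner h u)))))
    where
    fV-port : ∀ p → fV (port p) ≡ p
    fV-port p = cong [ id , (λ (h , _) → source (ends B h)) ]′ (decode-encode (inj₁ p))
    fV-inner : ∀ h u → fV (inner h u) ≡ source (ends B h)
    fV-inner h u = cong [ id , (λ (h , _) → source (ends B h)) ]′ (decode-encode (inj₂ (h , u)))

  unitBetween : Vertex → Vertex → Maybe (Fin (E B))
  unitBetween (inj₂ (h , _)) _              = just h
  unitBetween (inj₁ _)       (inj₂ (h , _)) = just h
  unitBetween (inj₁ _)       (inj₁ _)       = nothing

  interiorOf : Vertex → Maybe (Fin 6)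
  interiorOf (inj₁ _)       = nothing
  interiorOf (inj₂ (_ , u)) = just u

  edgeBetween : Fin (V B + E B * 6) → Fin (V B + E B * 6) → Maybe (Fin (E B * 10))
  edgeBetween v w = Maybe.zipWith combine (unitBetween (decode v) (decode w)) (gadgetEdgeBetween (interiorOf (decode v)) (interiorOf (decode w)))

  interiorOf-placed : ∀ h a → interiorOf (placed h a) ≡ interior a
  interiorOf-placed h 0F                    = refl
  interiorOf-placed h 1F                    = refl
  interiorOf-placed h (Fin.suc (Fin.suc _)) = refl

  unitBetween-placed : ∀ h a b → unitBetween (placed h a) (inj₂ (h , b)) ≡ just h
  unitBetween-placed h 0F                    b = refl
  unitBetween-placed h 1F                    b = refl
  unitBetween-placed h (Fin.suc (Fin.suc _)) b = refl

  edgeBetween-src-tgt : ∀ e → edgeBetween (src e) (tgt e) ≡ just e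
  edgeBetween-src-tgt e = begin
    edgeBetween (src e) (tgt e)
      ≡⟨ cong₂ (λ x y → Maybe.zipWith combine (unitBetween x y) (gadgetEdgeBetween (interiorOf x) (interiorOf y)))
               (decode-encode (placed h a)) (decode-encode (inj₂ (h , b))) ⟩
    Maybe.zipWith combine (unitBetween (placed h a) (inj₂ (h , b))) (gadgetEdgeBetween (interiorOf (placed h a)) (just b))
      ≡⟨ cong₂ (λ x y → Maybe.zipWith combine x (gadgetEdgeBetween y (just b))) (unitBetween-placed h a b) (interiorOf-placed h a) ⟩
    Maybe.zipWith combine (just h) (gadgetEdgeBetween (interior a) (just b))
      ≡⟨ cong (Maybe.zipWith combine (just h)) (gadgetEdgeBetween-ends (pieceOf e)) ⟩
    just (combine h (pieceOf e))
      ≡⟨ cong just (combine-remQuot {E B} 10 e) ⟩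
    just e ∎
    where
    open ≡-Reasoning
    h : Fin (E B)
    h = unitOf e
    a : Fin 8
    a = proj₁ (gadgetEdge (pieceOf e))
    b : Fin 6
    b = proj₂ (gadgetEdge (pieceOf e))

  edgeBetween-tgt-src : ∀ e → edgeBetween (tgt e) (src e) ≡ just e
  edgeBetween-tgt-src e = begin
    edgeBetween (tgt e) (src e)
      ≡⟨ cong₂ (λ x y → Maybe.zipWith combine (unitBetween x y) (gadgetEdgeBetween (interiorOf x) (interiorOf y)))
               (decode-encode (inj₂ (h , b))) (decode-encode (placed h a)) ⟩
    Maybe.zipWith combine (just h) (gadgetEdgeBetween (just b) (interiorOf (placed h a)))
      ≡⟨ cong (λ y → Maybe.zipWith combine (just h) (gadgetEdgeBetween (just b) y)) (interiorOf-placed h a) ⟩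
    Maybe.zipWith combine (just h) (gadgetEdgeBetween (just b) (interior a))
      ≡⟨ cong (Maybe.zipWith combine (just h)) (gadgetEdgeBetween-ends′ (pieceOf e)) ⟩
    just (combine h (pieceOf e))
      ≡⟨ cong just (combine-remQuot {E B} 10 e) ⟩
    just e ∎
    where
    open ≡-Reasoning
    h : Fin (E B)
    h = unitOf e
    a : Fin 8
    a = proj₁ (gadgetEdge (pieceOf e))
    b : Fin 6
    b = proj₂ (gadgetEdge (pieceOf e))

  simple : Simple replaced
  simple = normals-simple src tgt src≢tgt determined
    where
    determined : ∀ e e′ → (src e ≡ src e′ × tgt e ≡ tgt e′) ⊎ (src e ≡ tgt e′ × tgt e ≡ src e′) → e ≡ e′
    determined e e′ (inj₁ (src≡ , tgt≡)) =
      Maybe.just-injective (trans (sym (edgeBetween-src-tgt e)) (trans (cong₂ edgeBetween src≡ tgt≡) (edgeBetween-src-tgt e′)))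
    determined e e′ (inj₂ (src≡tgt , tgt≡src)) =
      Maybe.just-injective (trans (sym (edgeBetween-src-tgt e)) (trans (cong₂ edgeBetween src≡tgt tgt≡src) (edgeBetween-tgt-src e′)))

  pendants-agree : ∀ col → IsTaitColouring replaced col → ∀ h → col (combine h 1F) ≡ col (combine h 0F)
  pendants-agree col tait h = gadget-forcing (col ∘ combine h)
    (λ u c → trans (sym (weightedDegree-inner (λ e → δ (col e) c) h u)) (tait (inner h u) c))

  entryColouring : (Fin (E B * 10) → Fin 3) → Fin (E B) → Fin 3
  entryColouring col h = col (combine h 0F)

  tait-descends : ∀ col → IsTaitColouring replaced col → IsTaitColouring B (entryColouring col)
  tait-descends col tait p c = begin
    endsOver B (entryColouring col) c p
      ≡⟨ sum-cong-≗ onEdge ⟩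
    sum (λ h → δ (source (ends B h)) p * δ (col (combine h 0F)) c + δ (target (ends B h)) p * δ (col (combine h 1F)) c)
      ≡⟨ weightedDegree-port (λ e → δ (col e) c) p ⟨
    endsOver replaced col c (port p)
      ≡⟨ tait (port p) c ⟩
    1 ∎
    where
    open ≡-Reasoning
    onEdge : ∀ h → δ (col (combine h 0F)) c * endsAt (ends B h) p
                   ≡ δ (source (ends B h)) p * δ (col (combine h 0F)) c + δ (target (ends B h)) p * δ (col (combine h 1F)) c
    onEdge h = begin
      δ (col (combine h 0F)) c * endsAt (ends B h) p
        ≡⟨ cong (δ (col (combine h 0F)) c *_) (endsAt-nonSemi (ends B h) p (semiFree h)) ⟩
      δ (col (combine h 0F)) c * (δ (source (ends B h)) p + δ (target (ends B h)) p)
        ≡⟨ *-distribˡ-+ (δ (col (combine h 0F)) c) (δ (source (ends B h)) p) (δ (target (ends B h)) p) ⟩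
      δ (col (combine h 0F)) c * δ (source (ends B h)) p + δ (col (combine h 0F)) c * δ (target (ends B h)) p
        ≡⟨ cong₂ _+_ (*-comm _ (δ (source (ends B h)) p)) (trans (*-comm _ (δ (target (ends B h)) p)) (cong (λ x → δ (target (ends B h)) p * δ x c) (sym (pendants-agree col tait h)))) ⟩
      δ (source (ends B h)) p * δ (col (combine h 0F)) c + δ (target (ends B h)) p * δ (col (combine h 1F)) c ∎

theorem5 : ∀ (A : Graph) → Connected A → (A ▷ F 3 0) ⇔ (A ⟶ F 3 0)
theorem5 A A-connected = mk⇔ stronger⇒covers covers⇒stronger
  where
  covers⇒stronger : A ⟶ F 3 0 → A ▷ F 3 0
  covers⇒stronger (_ , π) _ _ (_ , ρ) = F30-connected , covering-trans ρ π

  stronger⇒covers : A ▷ F 3 0 → A ⟶ F 3 0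
  stronger⇒covers A▷F30 = F30-connected , tait⇒covering colour a₀ colour-tait
    where
    module S = SimpleCover A
    χ₁ : CoveringProjection S.cover (F 3 0)
    χ₁ = proj₂ (A▷F30 S.cover S.simple (A-connected , S.covering))
    a₀ : Fin (V A)
    a₀ = CoveringProjection.fV S.covering (proj₁ (CoveringProjection.surjV χ₁ 0F))
    module D = DoubleCover A
    module R = GadgetReplacement D.double (D.cubic (cubic-base S.covering χ₁)) D.semiFree
    χ₂ : CoveringProjection R.replaced (F 3 0)
    χ₂ = proj₂ (A▷F30 R.replaced R.simple (A-connected , covering-trans R.covering D.covering))
    colour : Fin (E A) → Fin 3
    colour = D.sheetColouring (R.entryColouring (CoveringProjection.fE χ₂))
    colour-tait : IsTaitColouring A colour
    colour-tait = D.tait-descends (R.entryColouring (CoveringProjection.fE χ₂)) (R.tait-descends (CoveringProjection.fE χ₂) (covering⇒tait χ₂))
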